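{- Work in the "linear" axiomatic framework for three-dimensional projective space described in the context (a set $\mathbb{L}$ of lines with an incidence relation $\sim$ satisfying Axioms [1]–[4]). Let $o, p, q, r \in \mathbb{L}$ be four pairwise-incident lines, and suppose that some three of them form a plane-triad. Then $o, p, q, r$ are coplanar (all four lie in one plane $\mathrm{pl}(x,y)$ for some incident pair of distinct lines $x, y$), and no three of them form a point-triad.
   Context: Let $\mathbb{L}$ be a set (whose elements are called lines) with a symmetric reflexive relation $\sim$ (incidence). Lines that are not incident are called skew. For $S \subseteq \mathbb{L}$ let $S^{\sim}$ be the set of all lines incident to every line of $S$, and write $[l_1 \dots l_n] = \{l_1,\dots,l_n\}^{\sim}$. The axioms are: Axiom [1]: for each line $l$, the set $\{l\}^{\sim}$ contains three pairwise skew lines. Axiom [2]: for each incident pair of distinct lines $a,b$: (2.1) $[ab]$ contains skew pairs of lines; (2.2) if $c \in [ab]\setminus[ab]^{\sim}$ is one of such a skew pair, then no skew pairs lie in $[abc]$; (2.3) if $x,y$ is a skew pair in $[ab]$ then $[ab] = [abx]\cup[aby]$. Axiom [3]: if $a,b$ is an incident line pair and $c \in [ab]\setminus[ab]^{\sim}$, then there exist an incident line pair $p,q$ and $r \in [pq]\setminus[pq]^{\sim}$ with $[abc]\cap[pqr]=\emptyset$. For incident distinct lines $a,b$ put $\Sigma(a,b) = [ab]\setminus[ab]^{\sim}$; incidence restricted to $\Sigma(a,b)$ is an equivalence relation with exactly two classes, which (as part of the structure) are labelled $\Sigma_{\mathrm{pt}}(a,b)$ and $\Sigma_{\mathrm{pl}}(a,b)$.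 The point $\mathrm{pt}(a,b) = [abc]$ with $c \in \Sigma_{\mathrm{pt}}(a,b)$ and the plane $\mathrm{pl}(a,b) = [abc]$ with $c \in \Sigma_{\mathrm{pl}}(a,b)$ are independent of the choice of $c$. Axiom [4]: whenever $a,b$ and $p,q$ are pairs of distinct incident lines, $\mathrm{pt}(a,b)\cap\mathrm{pt}(p,q)\neq\emptyset$ and $\mathrm{pl}(a,b)\cap\mathrm{pl}(p,q)\neq\emptyset$. A triad is a triple of pairwise-incident lines $a,b,c$ with $c \in \Sigma(a,b)$ (equivalently $a\in\Sigma(b,c)$, equivalently $b \in \Sigma(c,a)$). It is a plane-triad if $a\in\Sigma_{\mathrm{pl}}(b,c)$, $b\in\Sigma_{\mathrm{pl}}(c,a)$, $c\in\Sigma_{\mathrm{pl}}(a,b)$, and a point-triad if the same holds with $\mathrm{pt}$ in place of $\mathrm{pl}$; every triad is of exactly one of these two types. Lines are coplanar if they all lie in one plane $\mathrm{pl}(x,y)$ for some incident distinct $x,y$. -}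

module Defs where

open import Data.Product using (Σ; ∃; ∃-syntax; _×_; _,_)
open import Data.Sum using (_⊎_)
open import Data.Empty using (⊥)
open import Data.Fin using (Fin; zero; suc)
open import Relation.Nullary using (¬_)
open import Relation.Binary.PropositionalEquality using (_≡_; _≢_)

module LineNotions {L : Set} (_∼_ : L → L → Set) where

  In2 : L → L → L → Set
  In2 a b x = (x ∼ a) × (x ∼ b)

  In3 : L → L → L → L → Set
  In3 a b c x = (x ∼ a) × (x ∼ b) × (x ∼ c)

  Perp2 : L → L → L → Set
  Perp2 a b x = ∀ z → In2 a b z → x ∼ z

  Skew : L → L → Set
  Skew x y = ¬ (x ∼ y)

  SigmaL : L → L → L → Set
  SigmaL a b c = In2 a b c × ¬ (Perp2 a b c)

  IncPair : L → L → Set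
  IncPair a b = (a ∼ b) × (a ≢ b)

record LineSpace : Set₁ where
  field
    L    : Set
    _∼_  : L → L → Set
    ∼-refl : ∀ x → x ∼ x
    ∼-sym  : ∀ {x y} → x ∼ y → y ∼ x

  open LineNotions _∼_ public

  field
    ax1 : ∀ l → ∃[ x ] ∃[ y ] ∃[ z ]
            (x ∼ l) × (y ∼ l) × (z ∼ l) × Skew x y × Skew y z × Skew x z
    ax2-1 : ∀ a b → IncPair a b →
            ∃[ x ] ∃[ y ] In2 a b x × In2 a b y × Skew x y
    ax2-2 : ∀ a b c → IncPair a b → SigmaL a b c →
            (∃[ d ] In2 a b d × Skew c d) →
            ∀ x y → In3 a b c x → In3 a b c y → x ∼ y
    ax2-3 : ∀ a b x y → IncPair a b → In2 a b x → In2 a b y → Skew x y →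
            ∀ z → In2 a b z → In3 a b x z ⊎ In3 a b y z
    ax3 : ∀ a b c → IncPair a b → SigmaL a b c →
          ∃[ p ] ∃[ q ] ∃[ r ] IncPair p q × SigmaL p q r ×
            (∀ x → In3 a b c x → In3 p q r x → ⊥)

    -- Labelling of the two incidence classes of Σ(a,b) (for a, b distinct
    -- and incident): Σpt(a,b) and Σpl(a,b).
    Σpt Σpl : L → L → L → Set
    Σpt⊆Σ : ∀ a b c → IncPair a b → Σpt a b c → SigmaL a b c
    Σpl⊆Σ : ∀ a b c → IncPair a b → Σpl a b c → SigmaL a b c
    Σ-cover : ∀ a b c → IncPair a b → SigmaL a b c → Σpt a b c ⊎ Σpl a b c
    Σpt-inc : ∀ a b c d → IncPair a b → Σpt a b c → Σpt a b d → c ∼ d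
    Σpl-inc : ∀ a b c d → IncPair a b → Σpl a b c → Σpl a b d → c ∼ d
    Σpt-pl-skew : ∀ a b c d → IncPair a b → Σpt a b c → Σpl a b d → Skew c d
    Σpt-ne : ∀ a b → IncPair a b → ∃[ c ] Σpt a b c
    Σpl-ne : ∀ a b → IncPair a b → ∃[ c ] Σpl a b c

  -- the point pt(a,b) = [abc], c ∈ Σpt(a,b)   (as a predicate on lines)
  pt : L → L → L → Set
  pt a b x = ∃[ c ] Σpt a b c × In3 a b c x

  pl : L → L → L → Set
  pl a b x = ∃[ c ] Σpl a b c × In3 a b c x

  field
    ax4 : ∀ a b p q → IncPair a b → IncPair p q →
          (∃[ x ] pt a b x × pt p q x) × (∃[ x ] pl a b x × pl p q x)

  Triad : L → L → L → Set
  Triad a b c = (a ∼ b) × (b ∼ c) × (a ∼ c) × (a ≢ b) × SigmaL a b c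

  PlaneTriad : L → L → L → Set
  PlaneTriad a b c = Triad a b c × Σpl b c a × Σpl c a b × Σpl a b c

  PointTriad : L → L → L → Set
  PointTriad a b c = Triad a b c × Σpt b c a × Σpt c a b × Σpt a b c

  Coplanar : ∀ {n} → (Fin n → L) → Set
  Coplanar {n} v = ∃[ x ] ∃[ y ] IncPair x y × (∀ i → pl x y (v i))

quad : ∀ {A : Set} → A → A → A → A → Fin 4 → A
quad o p q r zero = o
quad o p q r (suc zero) = p
quad o p q r (suc (suc zero)) = q
quad o p q r (suc (suc (suc zero))) = r

-- For c ∈ Σ(a,b) the lines of [abc] are pairwise incident (Axiom 2.2), so
-- [abc] contains the point pt(a,b) or the plane pl(a,b), according to the
-- class of c. By Axiom [3] some [pqr] misses
-- [abc]; by Axiom [4] the point or plane [pqr] meets every point, resp. every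
-- plane, so [abc] cannot contain both a point and a plane. Four pairwise
-- incident lines containing a plane-triad a, b, c all lie in [abc] = pl(a,b);
-- a point-triad x, y, z among them would make [xyz] = pt(x,y) contain
-- [abc] = pl(a,b) as well.
module Submission where

open import Defs
open import Data.Product using (∃-syntax; _×_; _,_; proj₁; proj₂)
open import Data.Sum using (inj₁; inj₂)
open import Data.Empty using (⊥)
open import Data.Fin using (Fin)
open import Relation.Nullary using (¬_)
open import Relation.Unary using (_⊆_)
open import Axiom.ExcludedMiddle using (ExcludedMiddle)
open import Level using (0ℓ)

module _ (S : LineSpace) where
  open LineSpace S

  Σ-skew-partner : ∀ {a b c} → IncPair a b → SigmaL a b c →
                   ∃[ d ] In2 a b d × Skew c d
  Σ-skew-partner {a} {b} {c} ab c∈Σ with Σ-cover a b c ab c∈Σ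
  ... | inj₁ c∈pt with Σpl-ne a b ab
  ...   | d , d∈pl = d , proj₁ (Σpl⊆Σ a b d ab d∈pl) , Σpt-pl-skew a b c d ab c∈pt d∈pl
  Σ-skew-partner {a} {b} {c} ab c∈Σ | inj₂ c∈pl with Σpt-ne a b ab
  ...   | d , d∈pt = d , proj₁ (Σpt⊆Σ a b d ab d∈pt) ,
                     λ c∼d → Σpt-pl-skew a b d c ab d∈pt c∈pl (∼-sym c∼d)

  In3-incident : ∀ {a b c x y} → IncPair a b → SigmaL a b c →
                 In3 a b c x → In3 a b c y → x ∼ y
  In3-incident {a} {b} {c} {x} {y} ab c∈Σ =
    ax2-2 a b c ab c∈Σ (Σ-skew-partner ab c∈Σ) x y

  In3-⊆ : ∀ {a b c x y z} → IncPair a b → SigmaL a b c →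
          In3 a b c x → In3 a b c y → In3 a b c z → In3 a b c ⊆ In3 x y z
  In3-⊆ ab c∈Σ x∈ y∈ z∈ t∈ =
    In3-incident ab c∈Σ t∈ x∈ , In3-incident ab c∈Σ t∈ y∈ , In3-incident ab c∈Σ t∈ z∈

  In3-⊆-incident : ∀ {u v w w'} → IncPair u v → SigmaL u v w → SigmaL u v w' →
                   w ∼ w' → In3 u v w' ⊆ In3 u v w
  In3-⊆-incident uv w∈Σ w'∈Σ w∼w' t∈@(t∼u , t∼v , _) =
    let (w∼u , w∼v) = proj₁ w∈Σ
    in t∼u , t∼v , In3-incident uv w'∈Σ t∈ (w∼u , w∼v , w∼w')

  pt⊆In3 : ∀ {u v w} → IncPair u v → Σpt u v w → pt u v ⊆ In3 u v w
  pt⊆In3 {u} {v} {w} uv w∈pt (w' , w'∈pt , t∈) =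
    In3-⊆-incident uv (Σpt⊆Σ u v w uv w∈pt) (Σpt⊆Σ u v w' uv w'∈pt)
      (Σpt-inc u v w w' uv w∈pt w'∈pt) t∈

  pl⊆In3 : ∀ {u v w} → IncPair u v → Σpl u v w → pl u v ⊆ In3 u v w
  pl⊆In3 {u} {v} {w} uv w∈pl (w' , w'∈pl , t∈) =
    In3-⊆-incident uv (Σpl⊆Σ u v w uv w∈pl) (Σpl⊆Σ u v w' uv w'∈pl)
      (Σpl-inc u v w w' uv w∈pl w'∈pl) t∈

  ¬pt-pl-⊆In3 : ∀ {a b c u v u' v'} → IncPair a b → SigmaL a b c →
                IncPair u v → pt u v ⊆ In3 a b c →
                IncPair u' v' → pl u' v' ⊆ In3 a b c → ⊥
  ¬pt-pl-⊆In3 {a} {b} {c} {u} {v} {u'} {v'} ab c∈Σ uv pt⊆ u'v' pl⊆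
    with ax3 a b c ab c∈Σ
  ... | p , q , r , pq , r∈Σ , disjoint with Σ-cover p q r pq r∈Σ
  ...   | inj₁ r∈pt with proj₁ (ax4 u v p q uv pq)
  ...     | x , x∈pt , x∈pt' = disjoint x (pt⊆ x∈pt) (pt⊆In3 pq r∈pt x∈pt')
  ¬pt-pl-⊆In3 {a} {b} {c} {u} {v} {u'} {v'} ab c∈Σ uv pt⊆ u'v' pl⊆
      | p , q , r , pq , r∈Σ , disjoint | inj₂ r∈pl with proj₂ (ax4 u' v' p q u'v' pq)
  ...     | x , x∈pl , x∈pl' = disjoint x (pl⊆ x∈pl) (pl⊆In3 pq r∈pl x∈pl')

  ¬PointTriad-In3-Σpl : ∀ {a b c x y z} → IncPair a b → Σpl a b c →
                        In3 a b c x → In3 a b c y → In3 a b c z → ¬ PointTriad x y z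
  ¬PointTriad-In3-Σpl {a} {b} {c} ab c∈pl x∈ y∈ z∈
    ((x∼y , _ , _ , x≢y , z∈Σ) , _ , _ , z∈pt) =
    ¬pt-pl-⊆In3 xy z∈Σ xy (pt⊆In3 xy z∈pt) ab
      (λ t∈ → In3-⊆ ab (Σpl⊆Σ a b c ab c∈pl) x∈ y∈ z∈ (pl⊆In3 ab c∈pl t∈))
    where xy = x∼y , x≢y

theorem1 : ExcludedMiddle 0ℓ → (S : LineSpace) → let open LineSpace S in
    ∀ (o p q r : L) →
    (∀ (i j : Fin 4) → quad o p q r i ∼ quad o p q r j) →
    (∃[ i ] ∃[ j ] ∃[ k ] PlaneTriad (quad o p q r i) (quad o p q r j) (quad o p q r k)) →
    Coplanar (quad o p q r)
    × (∀ (i j k : Fin 4) → ¬ PointTriad (quad o p q r i) (quad o p q r j) (quad o p q r k))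
theorem1 _ S o p q r incident (a , b , c , ((a∼b , _ , _ , a≢b , _) , _ , _ , c∈pl)) =
  (l a , l b , ab , λ i → l c , c∈pl , in-abc i) ,
  λ i j k → ¬PointTriad-In3-Σpl S ab c∈pl (in-abc i) (in-abc j) (in-abc k)
  where
  open LineSpace S
  l = quad o p q r
  ab = a∼b , a≢b
  in-abc : ∀ i → In3 (l a) (l b) (l c) (l i)
  in-abc i = incident i a , incident i b , incident i c
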